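{- Let $X$ be a nonempty set and let $R$ be a ring of functions $X \to \mathbb{Z}$ (under pointwise operations) containing all constant functions. Then every first-order $\mathcal{L}^+_R$-formula $\varphi(x_1,\dots,x_d)$ is logically equivalent to an $\mathcal{L}^+_R$-formula with $R$-bounded quantifiers.
   Context: Languages: $\mathcal{L}_{Pres}=\{0,1,<,-,+\}$ (constants $0,1$, order, unary negation, binary addition); $\mathcal{L}^+_{Pres}=\mathcal{L}_{Pres}\cup\{D_n : n\in\mathbb{N}\}$ with $D_n$ a unary predicate for divisibility by $n$ ($D_0$ always false); $\mathcal{L}_R=\mathcal{L}_{Pres}\cup\{f_\alpha:\alpha\in R\}$ with $f_\alpha$ unary function symbols (written $\alpha\cdot s$), and $\mathcal{L}^+_R=\mathcal{L}_R\cup\{D_\alpha:\alpha\in R\}$ with $D_\alpha$ unary predicates. Semantics depend on a parameter $t\in X$: for an $\mathcal{L}^+_R$-formula $\varphi$, $\varphi_t$ is the $\mathcal{L}^+_{Pres}$-formula obtained by replacing each term $\alpha\cdot s$ by $s+\dots+s$ ($\alpha(t)$ copies) if $\alpha(t)>0$, by $-(s+\dots+s)$ ($|\alpha(t)|$ copies) if $\alpha(t)<0$, by $0$ if $\alpha(t)=0$, and each $D_\alpha(s)$ by $D_{\alpha(t)}(s)$ (always false if $\alpha(t)=0$); $\varphi_t$ is interpreted in $\mathbb{Z}$ in the usual way. Two $\mathcal{L}^+_R$-formulas $\varphi(x_1,\dots,x_d)$, $\psi(x_1,\dots,x_d)$ are logically equivalent if for every $t\in X$ and every $(k_1,\dots,k_d)\in\mathbb{Z}^d$,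 $\varphi_t(k_1,\dots,k_d)$ holds in $\mathbb{Z}$ iff $\psi_t(k_1,\dots,k_d)$ holds in $\mathbb{Z}$. An $R$-bounded existential quantifier applied to $\theta(\bar x,z)$ gives $\exists z\,[0\le z\le \alpha \wedge \theta(\bar x,z)]$ and an $R$-bounded universal quantifier gives $\forall z\,[0\le z\le\alpha\rightarrow\theta(\bar x,z)]$, for some $\alpha\in R$ (here $\alpha$ denotes the term $f_\alpha(1)$). An $\mathcal{L}^+_R$-formula with $R$-bounded quantifiers is a member of the smallest class of $\mathcal{L}^+_R$-formulas containing all atomic formulas and closed under Boolean combinations and $R$-bounded existential and universal quantifiers. Quantification is only over $\mathbb{Z}$-valued variables, never over $t$. -}

module Defs where

open import Data.Nat using (ℕ; suc)
open import Data.Fin using (Fin; zero; suc)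
open import Data.Integer using (ℤ; +_; _+_; _*_; -_; _<_)
open import Data.Integer.Divisibility using (_∣_)
open import Data.Product using (Σ; _×_; _,_; proj₁)
open import Data.Sum using (_⊎_)
open import Relation.Nullary using (¬_)
open import Relation.Binary.PropositionalEquality using (_≡_)

record IsFunRing {X : Set} (R : (X → ℤ) → Set) : Set where
  field
    const : (k : ℤ) → R (λ _ → k)
    add   : ∀ {f g} → R f → R g → R (λ x → f x + g x)
    neg   : ∀ {f} → R f → R (λ x → - f x)
    mul   : ∀ {f g} → R f → R g → R (λ x → f x * g x)

module _ {X : Set} (R : (X → ℤ) → Set) where

  Elt : Set
  Elt = Σ (X → ℤ) R

  data Term (n : ℕ) : Set where
    var  : Fin n → Term n
    zer  : Term n
    one  : Term n
    neg  : Term n → Term n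
    add  : Term n → Term n → Term n
    smul : Elt → Term n → Term n

  data Formula (n : ℕ) : Set where
    eq   : Term n → Term n → Formula n
    lt   : Term n → Term n → Formula n
    dvd  : Elt → Term n → Formula n
    fneg : Formula n → Formula n
    fand : Formula n → Formula n → Formula n
    for  : Formula n → Formula n → Formula n
    fimp : Formula n → Formula n → Formula n
    ex   : Formula (suc n) → Formula n
    all  : Formula (suc n) → Formula n

  le : ∀ {n} → Term n → Term n → Formula n
  le s u = for (lt s u) (eq s u)

  bnd : ∀ {n} → Elt → Formula (suc n)
  bnd α = fand (le zer (var zero)) (le (var zero) (smul α one))

  bex : ∀ {n} → Elt → Formula (suc n) → Formula n
  bex α θ = ex (fand (bnd α) θ)

  ball : ∀ {n} → Elt → Formula (suc n) → Formula n
  ball α θ = all (fimp (bnd α) θ)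

  data Bounded : ∀ {n} → Formula n → Set where
    b-eq   : ∀ {n} (s u : Term n) → Bounded (eq s u)
    b-lt   : ∀ {n} (s u : Term n) → Bounded (lt s u)
    b-dvd  : ∀ {n} (α : Elt) (s : Term n) → Bounded (dvd α s)
    b-neg  : ∀ {n} {φ : Formula n} → Bounded φ → Bounded (fneg φ)
    b-and  : ∀ {n} {φ ψ : Formula n} → Bounded φ → Bounded ψ → Bounded (fand φ ψ)
    b-or   : ∀ {n} {φ ψ : Formula n} → Bounded φ → Bounded ψ → Bounded (for φ ψ)
    b-imp  : ∀ {n} {φ ψ : Formula n} → Bounded φ → Bounded ψ → Bounded (fimp φ ψ)
    b-bex  : ∀ {n} (α : Elt) {θ : Formula (suc n)} → Bounded θ → Bounded (bex α θ)
    b-ball : ∀ {n} (α : Elt) {θ : Formula (suc n)} → Bounded θ → Bounded (ball α θ)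

  -- semantics at parameter t : X (this is the meaning of φ_t in ℤ:
  -- α·s ↦ α(t)·s, D_α(s) ↦ D_{α(t)}(s), D_0 false)
  ext : ∀ {n} → ℤ → (Fin n → ℤ) → Fin (suc n) → ℤ
  ext z ρ zero    = z
  ext z ρ (suc i) = ρ i

  ⟦_⟧ᵗ : ∀ {n} → Term n → X → (Fin n → ℤ) → ℤ
  ⟦ var i    ⟧ᵗ t ρ = ρ i
  ⟦ zer      ⟧ᵗ t ρ = + 0
  ⟦ one      ⟧ᵗ t ρ = + 1
  ⟦ neg s    ⟧ᵗ t ρ = - ⟦ s ⟧ᵗ t ρ
  ⟦ add s u  ⟧ᵗ t ρ = ⟦ s ⟧ᵗ t ρ + ⟦ u ⟧ᵗ t ρ
  ⟦ smul α s ⟧ᵗ t ρ = proj₁ α t * ⟦ s ⟧ᵗ t ρ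

  Sat : ∀ {n} → Formula n → X → (Fin n → ℤ) → Set
  Sat (eq s u)   t ρ = ⟦ s ⟧ᵗ t ρ ≡ ⟦ u ⟧ᵗ t ρ
  Sat (lt s u)   t ρ = ⟦ s ⟧ᵗ t ρ < ⟦ u ⟧ᵗ t ρ
  Sat (dvd α s)  t ρ = ¬ (proj₁ α t ≡ + 0) × (proj₁ α t ∣ ⟦ s ⟧ᵗ t ρ)
  Sat (fneg φ)   t ρ = ¬ Sat φ t ρ
  Sat (fand φ ψ) t ρ = Sat φ t ρ × Sat ψ t ρ
  Sat (for φ ψ)  t ρ = Sat φ t ρ ⊎ Sat ψ t ρ
  Sat (fimp φ ψ) t ρ = Sat φ t ρ → Sat ψ t ρ
  Sat (ex φ)     t ρ = Σ ℤ λ z → Sat φ t (ext z ρ)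
  Sat (all φ)    t ρ = (z : ℤ) → Sat φ t (ext z ρ)

  LogEquiv : ∀ {d} → Formula d → Formula d → Set
  LogEquiv φ ψ = (t : X) (k : Fin _ → ℤ) → (Sat φ t k → Sat ψ t k) × (Sat ψ t k → Sat φ t k)

-- It suffices to eliminate one ∃ in front of a formula θ(y, x̄) with R-bounded
-- quantifiers, uniformly in t (∀ reduces to ∃ since bounded formulas are decidable).
-- Let P(t) be a common multiple of the nonzero divisors α(t) in θ and N ≥ P an
-- element of R.  Read each atom as a linear form c·y + r in y: divisibility atoms are
-- P-periodic in y, and a comparison atom keeps its truth value under y ↦ y ± P
-- unless |c·y + r| ≤ K_c := (c² + 1)·N.  So if θ(y) holds but θ(y ± P) fails, some
-- atom has |c·y + r| ≤ K_c, and such a y is found by a bounded search over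
-- c·y + r + K_c ∈ [0, 2K_c].  Without such a crossing, θ(z) implies θ at the residue
-- of z modulo P, which a search over [0, N] finds.
module Submission where

open import Defs
open import Data.Nat as ℕ using (ℕ; zero; suc)
import Data.Nat.Properties as ℕP
import Data.Nat.Divisibility as ℕD
open import Data.Nat.ListAction using (product)
open import Data.Nat.ListAction.Properties using (∈⇒∣product; product≢0)
open import Data.Fin using (Fin; zero; suc; _↑ʳ_)
open import Data.Integer as ℤ
  using (ℤ; +_; -[1+_]; +0; +[1+_]; 0ℤ; 1ℤ; _+_; _-_; _*_; -_; _<_; _≤_; ∣_∣)
import Data.Integer.Properties as ℤP
import Data.Integer.DivMod as ℤDM
open import Data.Integer.Divisibility using (_∣_)
import Data.Integer.Divisibility as ℤD
import Data.Integer.Divisibility.Signed as ℤS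
open import Data.Integer.Tactic.RingSolver using (solve-∀)
open import Data.List using (List; []; _∷_; _++_; map; foldr)
import Data.List.Relation.Unary.All as All
import Data.List.Relation.Unary.All.Properties as All
open import Data.List.Relation.Unary.Any using (here)
open import Data.List.Membership.Propositional using (_∈_)
open import Data.List.Membership.Propositional.Properties using (∈-++⁺ˡ; ∈-++⁺ʳ; ∈-map⁺)
open import Data.Maybe using (Maybe; just; nothing; maybe′)
import Data.Maybe as Maybe
open import Data.Product using (Σ; Σ-syntax; ∃; _×_; _,_; proj₁; proj₂)
open import Data.Sum using (_⊎_; inj₁; inj₂; [_,_]′)
import Data.Sum as Sum
open import Data.Empty using (⊥-elim)
open import Function using (_∘_)
open import Relation.Nullary using (¬_; Dec; yes; no)
open import Relation.Nullary.Decidable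
  using (_×-dec_; _⊎-dec_; _→-dec_; ¬?; map′; decidable-stable)
open import Relation.Binary.PropositionalEquality
  using (_≡_; _≢_; _≗_; refl; sym; trans; cong; cong₂; subst; subst₂; module ≡-Reasoning)

infix 3 _⇔_
_⇔_ : Set → Set → Set
A ⇔ B = (A → B) × (B → A)

⇔-refl : ∀ {A} → A ⇔ A
⇔-refl = (λ a → a) , (λ a → a)

⇔-sym : ∀ {A B} → A ⇔ B → B ⇔ A
⇔-sym (f , g) = g , f

⇔-trans : ∀ {A B C} → A ⇔ B → B ⇔ C → A ⇔ C
⇔-trans (f , g) (f′ , g′) = f′ ∘ f , g ∘ g′

¬-cong : ∀ {A B} → A ⇔ B → (¬ A) ⇔ (¬ B)
¬-cong (f , g) = (λ ¬a → ¬a ∘ g) , (λ ¬b → ¬b ∘ f)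

×-cong : ∀ {A B C D} → A ⇔ B → C ⇔ D → (A × C) ⇔ (B × D)
×-cong (f , g) (f′ , g′) = (λ (a , c) → f a , f′ c) , (λ (b , d) → g b , g′ d)

⊎-cong : ∀ {A B C D} → A ⇔ B → C ⇔ D → (A ⊎ C) ⇔ (B ⊎ D)
⊎-cong (f , g) (f′ , g′) = Sum.map f f′ , Sum.map g g′

→-cong : ∀ {A B C D} → A ⇔ B → C ⇔ D → (A → C) ⇔ (B → D)
→-cong (f , g) (f′ , g′) = (λ h → f′ ∘ h ∘ g) , (λ h → g′ ∘ h ∘ f)

module _ {A : Set} {B P Q : A → Set} where

  ∃-cong-on : (∀ a → B a → P a ⇔ Q a) → (∃ λ a → B a × P a) ⇔ (∃ λ a → B a × Q a)
  ∃-cong-on P⇔Q = (λ (a , b , p) → a , b , proj₁ (P⇔Q a b) p)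
                , (λ (a , b , q) → a , b , proj₂ (P⇔Q a b) q)

  ∀-cong-on : (∀ a → B a → P a ⇔ Q a) → (∀ a → B a → P a) ⇔ (∀ a → B a → Q a)
  ∀-cong-on P⇔Q = (λ h a b → proj₁ (P⇔Q a b) (h a b)) , (λ h a b → proj₂ (P⇔Q a b) (h a b))

module _ {A : Set} {P Q : A → Set} where

  ∃-cong : (∀ a → P a ⇔ Q a) → (∃ P) ⇔ (∃ Q)
  ∃-cong P⇔Q = (λ (a , p) → a , proj₁ (P⇔Q a) p) , (λ (a , q) → a , proj₂ (P⇔Q a) q)

  ∀-cong : (∀ a → P a ⇔ Q a) → (∀ a → P a) ⇔ (∀ a → Q a)
  ∀-cong P⇔Q = (λ h a → proj₁ (P⇔Q a) (h a)) , (λ h a → proj₂ (P⇔Q a) (h a))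

∀⇔¬∃¬ : ∀ {A : Set} {P : A → Set} → (∀ a → Dec (P a)) → (∀ a → P a) ⇔ (¬ ∃ λ a → ¬ P a)
∀⇔¬∃¬ P? = (λ h (a , ¬p) → ¬p (h a)) , (λ ¬∃ a → decidable-stable (P? a) (λ ¬p → ¬∃ (a , ¬p)))

product-map-mono : ∀ {A : Set} {f g : A → ℕ} → (∀ a → f a ℕ.≤ g a) →
                   ∀ as → product (map f as) ℕ.≤ product (map g as)
product-map-mono f≤g []       = ℕP.≤-refl
product-map-mono f≤g (a ∷ as) = ℕP.*-mono-≤ (f≤g a) (product-map-mono f≤g as)

≡⇔-≡0 : ∀ {a b} → (a ≡ b) ⇔ (a - b ≡ 0ℤ)
≡⇔-≡0 = ℤP.i≡j⇒i-j≡0 , ℤP.i-j≡0⇒i≡j _ _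

<⇔-<0 : ∀ {a b} → (a < b) ⇔ (a - b < 0ℤ)
<⇔-<0 {a} {b} =
  (λ a<b → subst (a - b <_) (ℤP.+-inverseʳ b) (ℤP.+-monoˡ-< (- b) a<b)) ,
  (λ a-b<0 → subst₂ _<_ (a-b+b≡a a b) (ℤP.+-identityˡ b) (ℤP.+-monoˡ-< b a-b<0))
  where
  a-b+b≡a : ∀ a b → a - b + b ≡ a
  a-b+b≡a = solve-∀

SameSign : ℤ → ℤ → Set
SameSign a b = (a ≡ 0ℤ ⇔ b ≡ 0ℤ) × (a < 0ℤ ⇔ b < 0ℤ)

sameSign-refl : ∀ {a} → SameSign a a
sameSign-refl = ⇔-refl , ⇔-refl

positive-sameSign : ∀ {a b} → 0ℤ < a → 0ℤ < b → SameSign a b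
positive-sameSign 0<a 0<b =
  ((λ a≡0 → ⊥-elim (ℤP.<⇒≢ 0<a (sym a≡0))) , (λ b≡0 → ⊥-elim (ℤP.<⇒≢ 0<b (sym b≡0)))) ,
  ((λ a<0 → ⊥-elim (ℤP.<-asym 0<a a<0)) , (λ b<0 → ⊥-elim (ℤP.<-asym 0<b b<0)))

negative-sameSign : ∀ {a b} → a < 0ℤ → b < 0ℤ → SameSign a b
negative-sameSign a<0 b<0 =
  ((λ a≡0 → ⊥-elim (ℤP.<⇒≢ a<0 a≡0)) , (λ b≡0 → ⊥-elim (ℤP.<⇒≢ b<0 b≡0))) ,
  ((λ _ → b<0) , (λ _ → a<0))

Within : ℤ → ℤ → Set
Within K e = 0ℤ ≤ K × - K ≤ e × e ≤ K

far-from-0-sameSign : ∀ {a e K} → Within K e → K < a ⊎ a < - K → SameSign a (a + e)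
far-from-0-sameSign {a} {e} {K} (0≤K , -K≤e , e≤K) (inj₁ K<a) = positive-sameSign
  (ℤP.≤-<-trans 0≤K K<a)
  (subst (_< a + e) (ℤP.+-inverseʳ K) (ℤP.+-mono-<-≤ K<a -K≤e))
far-from-0-sameSign {a} {e} {K} (0≤K , -K≤e , e≤K) (inj₂ a<-K) = negative-sameSign
  (ℤP.<-≤-trans a<-K (ℤP.neg-mono-≤ 0≤K))
  (subst (a + e <_) (ℤP.+-inverseˡ K) (ℤP.+-mono-<-≤ a<-K e≤K))

near-0-window : ∀ {a K} → ¬ K < a → ¬ a < - K → 0ℤ ≤ a + K × a + K ≤ K + K
near-0-window {a} {K} K≮a a≮-K =
  subst (_≤ a + K) (ℤP.+-inverseˡ K) (ℤP.+-monoˡ-≤ K (ℤP.≮⇒≥ a≮-K)) ,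
  ℤP.+-monoˡ-≤ K (ℤP.≮⇒≥ K≮a)

∣i∣≤n⇒-n≤i≤n : ∀ {i n} → ∣ i ∣ ℕ.≤ n → - + n ≤ i × i ≤ + n
∣i∣≤n⇒-n≤i≤n {+ _}      ∣i∣≤n           = ℤP.neg-≤-pos , ℤ.+≤+ ∣i∣≤n
∣i∣≤n⇒-n≤i≤n { -[1+ _ ]} (ℕ.s≤s ∣i∣≤n) = ℤ.-≤- ∣i∣≤n , ℤ.-≤+

∣_∣²+1 : ℤ → ℕ
∣ i ∣²+1 = ∣ i ∣ ℕ.* ∣ i ∣ ℕ.+ 1

i*i+1≡∣i∣²+1 : ∀ i → i * i + 1ℤ ≡ + ∣ i ∣²+1
i*i+1≡∣i∣²+1 +0       = refl
i*i+1≡∣i∣²+1 +[1+ _ ] = refl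
i*i+1≡∣i∣²+1 -[1+ _ ] = refl

m≤m*m+1 : ∀ m → m ℕ.≤ m ℕ.* m ℕ.+ 1
m≤m*m+1 zero    = ℕ.z≤n
m≤m*m+1 (suc m) = ℕP.≤-trans (ℕP.m≤m*n (suc m) (suc m)) (ℕP.m≤m+n (suc m ℕ.* suc m) 1)

*-within : ∀ c δ {N} → ∣ δ ∣ ℕ.≤ N → Within ((c * c + 1ℤ) * + N) (c * δ)
*-within c δ {N} ∣δ∣≤N = subst (λ K → Within K (c * δ)) (sym K≡) (ℤ.+≤+ ℕ.z≤n , ∣i∣≤n⇒-n≤i≤n ∣cδ∣≤)
  where
  K≡ : (c * c + 1ℤ) * + N ≡ + (∣ c ∣²+1 ℕ.* N)
  K≡ = trans (cong (_* + N) (i*i+1≡∣i∣²+1 c)) (sym (ℤP.pos-* ∣ c ∣²+1 N))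
  ∣cδ∣≤ : ∣ c * δ ∣ ℕ.≤ ∣ c ∣²+1 ℕ.* N
  ∣cδ∣≤ = subst (ℕ._≤ _) (sym (ℤP.abs-* c δ)) (ℕP.*-mono-≤ (m≤m*m+1 ∣ c ∣) ∣δ∣≤N)

∣-shift : ∀ {β δ} a c → β ∣ δ → (β ∣ a) ⇔ (β ∣ a + c * δ)
∣-shift {β} {δ} a c β∣δ =
  (λ β∣a → ℤS.∣⇒∣ᵤ {β} {a + c * δ} (ℤS.∣m∣n⇒∣m+n (ℤS.∣ᵤ⇒∣ {β} {a} β∣a) β∣cδ)) ,
  (λ β∣a+cδ → ℤS.∣⇒∣ᵤ {β} {a} (ℤS.∣m+n∣n⇒∣m (ℤS.∣ᵤ⇒∣ {β} {a + c * δ} β∣a+cδ) β∣cδ))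
  where
  β∣cδ : β ℤS.∣ c * δ
  β∣cδ = ℤS.∣n⇒∣m*n c (ℤS.∣ᵤ⇒∣ {β} {δ} β∣δ)

*-cancelˡ-≡-⇔ : ∀ c {a b} → c ≢ 0ℤ → (c * a ≡ c * b) ⇔ (a ≡ b)
*-cancelˡ-≡-⇔ c {a} {b} c≢0 = ℤP.*-cancelˡ-≡ c a b {{ℤ.≢-nonZero c≢0}} , cong (c *_)

*-cancelˡ-<-⇔ : ∀ c {a b} → c ≢ 0ℤ →
                ((0ℤ < c × c * a < c * b) ⊎ (c < 0ℤ × c * b < c * a)) ⇔ (a < b)
*-cancelˡ-<-⇔ +0 c≢0 = ⊥-elim (c≢0 refl)
*-cancelˡ-<-⇔ c@(+[1+ _ ]) _ =
  (λ { (inj₁ (_ , ca<cb)) → ℤP.*-cancelˡ-<-nonNeg c ca<cb ; (inj₂ (ℤ.+<+ () , _)) }) ,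
  (λ a<b → inj₁ (ℤ.+<+ (ℕ.s≤s ℕ.z≤n) , ℤP.*-monoˡ-<-pos c a<b))
*-cancelˡ-<-⇔ c@(-[1+ k ]) _ =
  (λ { (inj₁ (() , _)) ; (inj₂ (_ , cb<ca)) → ℤP.*-cancelˡ-<-neg k cb<ca }) ,
  (λ a<b → inj₂ (ℤ.-<+ , ℤP.*-monoˡ-<-neg c a<b))

*-cancelˡ-∣-⇔ : ∀ c {β s} → c ≢ 0ℤ → (c * β ≢ 0ℤ × c * β ∣ c * s) ⇔ (β ≢ 0ℤ × β ∣ s)
*-cancelˡ-∣-⇔ c {β} {s} c≢0 =
  (λ (cβ≢0 , cβ∣cs) → (λ β≡0 → cβ≢0 (trans (cong (c *_) β≡0) (ℤP.*-zeroʳ c))) ,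
                      ℤD.*-cancelˡ-∣ c {β} {s} {{ℤ.≢-nonZero c≢0}} cβ∣cs) ,
  (λ (β≢0 , β∣s) → (λ cβ≡0 → [ c≢0 , β≢0 ]′ (ℤP.i*j≡0⇒i≡0∨j≡0 c cβ≡0)) , ℤD.*-monoʳ-∣ c {β} {s} β∣s)

∣_∣⁺ : ℤ → ℕ
∣ +0 ∣⁺       = 1
∣ +[1+ n ] ∣⁺ = suc n
∣ -[1+ n ] ∣⁺ = suc n

∣i∣⁺-nonZero : ∀ i → ℕ.NonZero ∣ i ∣⁺
∣i∣⁺-nonZero +0       = _
∣i∣⁺-nonZero +[1+ _ ] = _
∣i∣⁺-nonZero -[1+ _ ] = _

∣i∣⁺≤∣i∣²+1 : ∀ i → ∣ i ∣⁺ ℕ.≤ ∣ i ∣²+1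
∣i∣⁺≤∣i∣²+1 +0           = ℕP.≤-refl
∣i∣⁺≤∣i∣²+1 i@(+[1+ _ ]) = m≤m*m+1 ∣ i ∣
∣i∣⁺≤∣i∣²+1 i@(-[1+ _ ]) = m≤m*m+1 ∣ i ∣

∣i∣≡∣i∣⁺ : ∀ {i} → i ≢ 0ℤ → ∣ i ∣ ≡ ∣ i ∣⁺
∣i∣≡∣i∣⁺ {+0}       i≢0 = ⊥-elim (i≢0 refl)
∣i∣≡∣i∣⁺ {+[1+ _ ]} _   = refl
∣i∣≡∣i∣⁺ { -[1+ _ ]} _  = refl

InRange : ℤ → ℤ → Set
InRange A z = (0ℤ < z ⊎ 0ℤ ≡ z) × (z < A ⊎ z ≡ A)

≤⇔<⊎≡ : ∀ {i j} → i ≤ j ⇔ (i < j ⊎ i ≡ j)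
≤⇔<⊎≡ {i} {j} = to , [ ℤP.<⇒≤ , ℤP.≤-reflexive ]′
  where
  to : i ≤ j → i < j ⊎ i ≡ j
  to i≤j with i ℤ.≟ j
  ... | yes i≡j = inj₂ i≡j
  ... | no  i≢j = inj₁ (ℤP.≤∧≢⇒< i≤j i≢j)

inRange⇔ : ∀ {A z} → InRange A z ⇔ (0ℤ ≤ z × z ≤ A)
inRange⇔ = ×-cong (⇔-sym ≤⇔<⊎≡) (⇔-sym ≤⇔<⊎≡)

∃-inRange? : ∀ {P : ℤ → Set} → (∀ z → Dec (P z)) → ∀ A → Dec (∃ λ z → InRange A z × P z)
∃-inRange? P? -[1+ a ] = no λ (z , z∈ , _) →
  let (0≤z , z≤A) = proj₁ inRange⇔ z∈ in 0≰-[1+] (ℤP.≤-trans 0≤z z≤A)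
  where
  0≰-[1+] : ¬ 0ℤ ≤ -[1+ a ]
  0≰-[1+] ()
∃-inRange? {P} P? (+ m) = map′ from to (ℕP.anyUpTo? (P? ∘ +_) (suc m))
  where
  from : (∃ λ k → k ℕ.< suc m × P (+ k)) → ∃ λ z → InRange (+ m) z × P z
  from (k , ℕ.s≤s k≤m , p) = + k , proj₂ inRange⇔ (ℤ.+≤+ ℕ.z≤n , ℤ.+≤+ k≤m) , p
  to : (∃ λ z → InRange (+ m) z × P z) → ∃ λ k → k ℕ.< suc m × P (+ k)
  to (+ k , z∈ , p) with proj₁ inRange⇔ z∈
  ... | _ , ℤ.+≤+ k≤m = k , ℕ.s≤s k≤m , p
  to (-[1+ _ ] , z∈ , _) with proj₁ inRange⇔ z∈
  ... | () , _

∀-inRange? : ∀ {P : ℤ → Set} → (∀ z → Dec (P z)) → ∀ A → Dec (∀ z → InRange A z → P z)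
∀-inRange? P? A = map′
  (λ ¬∃ z z∈ → decidable-stable (P? z) (λ ¬p → ¬∃ (z , z∈ , ¬p)))
  (λ h (z , z∈ , ¬p) → ¬p (h z z∈))
  (¬? (∃-inRange? (¬? ∘ P?) A))

-- Crossings of a decidable predicate on ℤ

module _ {Th : ℤ → Set} (Th? : ∀ z → Dec (Th z)) where

  Crossing : ℕ → Set
  Crossing P = Σ[ y ∈ ℤ ] Σ[ δ ∈ ℤ ] ∣ δ ∣ ≡ P × Th y × ¬ Th (y + δ)

  start-or-crossing : ∀ d m w → Th (w + + m * d) → Th w ⊎ Crossing ∣ d ∣
  start-or-crossing d zero    w th = inj₁ (subst Th (ℤP.+-identityʳ w) th)
  start-or-crossing d (suc m) w th with Th? (w + + m * d)
  ... | yes th′ = start-or-crossing d m w th′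
  ... | no ¬th′ =
    inj₂ (w + + suc m * d , - d , ℤP.∣-i∣≡∣i∣ d , th , ¬th′ ∘ subst Th (step-back w (+ m) d))
    where
    step-back : ∀ w k d → w + (1ℤ + k) * d + - d ≡ w + k * d
    step-back = solve-∀

  residue-or-crossing : ∀ P .{{_ : ℕ.NonZero P}} {z} → Th z →
                        (∃ λ r → r ℕ.< P × Th (+ r)) ⊎ Crossing P
  residue-or-crossing P {z} th = from-quotient (z ℤDM./ℕ P) (subst Th (ℤDM.a≡a%ℕn+[a/ℕn]*n z P) th)
    where
    r = z ℤDM.%ℕ P

    at-residue : Th (+ r) ⊎ Crossing P → (∃ λ r → r ℕ.< P × Th (+ r)) ⊎ Crossing P
    at-residue = Sum.map₁ (λ th → r , ℤDM.n%ℕd<d z P , th)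

    -[1+k]*p≡[1+k]*-p : ∀ k p → -[1+ k ] * + p ≡ + suc k * - + p
    -[1+k]*p≡[1+k]*-p k p =
      trans (sym (ℤP.neg-distribˡ-* (+ suc k) (+ p))) (ℤP.neg-distribʳ-* (+ suc k) (+ p))

    from-quotient : ∀ q → Th (+ r + q * + P) → (∃ λ r → r ℕ.< P × Th (+ r)) ⊎ Crossing P
    from-quotient (+ m)      th = at-residue (start-or-crossing (+ P) m (+ r) th)
    from-quotient -[1+ k ] th = at-residue (Sum.map₂ (subst Crossing (ℤP.∣-i∣≡∣i∣ (+ P)))
      (start-or-crossing (- + P) (suc k) (+ r)
        (subst Th (cong (λ v → + r + v) (-[1+k]*p≡[1+k]*-p k P)) th)))

module QuantifierElimination {X : Set} (R : (X → ℤ) → Set) (isFunRing : IsFunRing R) where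
  open IsFunRing isFunRing using () renaming (const to const∈R; add to +∈R; neg to -∈R; mul to *∈R)

  _⟨_⟩ : Elt R → X → ℤ
  α ⟨ t ⟩ = proj₁ α t

  constᴿ : ℤ → Elt R
  constᴿ k = (λ _ → k) , const∈R k

  infixl 6 _+ᴿ_
  infixl 7 _*ᴿ_

  _+ᴿ_ : Elt R → Elt R → Elt R
  (f , f∈R) +ᴿ (g , g∈R) = (λ t → f t + g t) , +∈R f∈R g∈R

  _*ᴿ_ : Elt R → Elt R → Elt R
  (f , f∈R) *ᴿ (g , g∈R) = (λ t → f t * g t) , *∈R f∈R g∈R

  -ᴿ_ : Elt R → Elt R
  -ᴿ (f , f∈R) = (λ t → - f t) , -∈R f∈R

  Env : ℕ → Set
  Env n = Fin n → ℤ

  ⟦_⟧ : ∀ {n} → Term R n → X → Env n → ℤ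
  ⟦_⟧ = ⟦_⟧ᵗ R

  infixr 5 _∷ₑ_
  _∷ₑ_ : ∀ {n} → ℤ → Env n → Env (suc n)
  _∷ₑ_ = ext R

  rename : ∀ {n m} → (Fin n → Fin m) → Term R n → Term R m
  rename f (var i)    = var (f i)
  rename f zer        = zer
  rename f one        = one
  rename f (neg s)    = neg (rename f s)
  rename f (add s u)  = add (rename f s) (rename f u)
  rename f (smul α s) = smul α (rename f s)

  ⟦rename⟧ : ∀ {n m} (f : Fin n → Fin m) s {t} {ρ : Env m} → ⟦ rename f s ⟧ t ρ ≡ ⟦ s ⟧ t (ρ ∘ f)
  ⟦rename⟧ f (var i)        = refl
  ⟦rename⟧ f zer            = refl
  ⟦rename⟧ f one            = refl
  ⟦rename⟧ f (neg s)        = cong -_ (⟦rename⟧ f s)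
  ⟦rename⟧ f (add s u)      = cong₂ _+_ (⟦rename⟧ f s) (⟦rename⟧ f u)
  ⟦rename⟧ f (smul α s) {t} = cong (α ⟨ t ⟩ *_) (⟦rename⟧ f s)

  data BFormula (n : ℕ) : Set where
    eqᵇ ltᵇ          : Term R n → Term R n → BFormula n
    dvdᵇ             : Elt R → Term R n → BFormula n
    negᵇ             : BFormula n → BFormula n
    andᵇ orᵇ impᵇ    : BFormula n → BFormula n → BFormula n
    bexᵇ ballᵇ       : Elt R → BFormula (suc n) → BFormula n

  embed : ∀ {n} → BFormula n → Formula R n
  embed (eqᵇ s u)   = eq s u
  embed (ltᵇ s u)   = lt s u
  embed (dvdᵇ α s)  = dvd α s
  embed (negᵇ φ)    = fneg (embed φ)
  embed (andᵇ φ ψ)  = fand (embed φ) (embed ψ)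
  embed (orᵇ φ ψ)   = for (embed φ) (embed ψ)
  embed (impᵇ φ ψ)  = fimp (embed φ) (embed ψ)
  embed (bexᵇ α φ)  = bex R α (embed φ)
  embed (ballᵇ α φ) = ball R α (embed φ)

  embed-bounded : ∀ {n} (φ : BFormula n) → Bounded R (embed φ)
  embed-bounded (eqᵇ s u)   = b-eq s u
  embed-bounded (ltᵇ s u)   = b-lt s u
  embed-bounded (dvdᵇ α s)  = b-dvd α s
  embed-bounded (negᵇ φ)    = b-neg (embed-bounded φ)
  embed-bounded (andᵇ φ ψ)  = b-and (embed-bounded φ) (embed-bounded ψ)
  embed-bounded (orᵇ φ ψ)   = b-or (embed-bounded φ) (embed-bounded ψ)
  embed-bounded (impᵇ φ ψ)  = b-imp (embed-bounded φ) (embed-bounded ψ)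
  embed-bounded (bexᵇ α φ)  = b-bex α (embed-bounded φ)
  embed-bounded (ballᵇ α φ) = b-ball α (embed-bounded φ)

  Holds : ∀ {n} → BFormula n → X → Env n → Set
  Holds φ = Sat R (embed φ)

  falseᵇ : ∀ {n} → BFormula n
  falseᵇ = ltᵇ zer zer

  holds? : ∀ {n} (φ : BFormula n) t ρ → Dec (Holds φ t ρ)
  holds? (eqᵇ s u)   t ρ = ⟦ s ⟧ t ρ ℤ.≟ ⟦ u ⟧ t ρ
  holds? (ltᵇ s u)   t ρ = ⟦ s ⟧ t ρ ℤP.<? ⟦ u ⟧ t ρ
  holds? (dvdᵇ α s)  t ρ = ¬? (α ⟨ t ⟩ ℤ.≟ 0ℤ) ×-dec (∣ α ⟨ t ⟩ ∣ ℕD.∣? ∣ ⟦ s ⟧ t ρ ∣)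
  holds? (negᵇ φ)    t ρ = ¬? (holds? φ t ρ)
  holds? (andᵇ φ ψ)  t ρ = holds? φ t ρ ×-dec holds? ψ t ρ
  holds? (orᵇ φ ψ)   t ρ = holds? φ t ρ ⊎-dec holds? ψ t ρ
  holds? (impᵇ φ ψ)  t ρ = holds? φ t ρ →-dec holds? ψ t ρ
  holds? (bexᵇ α φ)  t ρ = ∃-inRange? (λ z → holds? φ t (z ∷ₑ ρ)) (α ⟨ t ⟩ * 1ℤ)
  holds? (ballᵇ α φ) t ρ = ∀-inRange? (λ z → holds? φ t (z ∷ₑ ρ)) (α ⟨ t ⟩ * 1ℤ)

  -- Linear forms in one variable

  -- In a context m + suc n the eliminated variable y has index m; the m variables
  -- below it are bound by bounded quantifiers of θ.
  exceptAt : ∀ m {n} → Fin (m ℕ.+ suc n) → Maybe (Fin (m ℕ.+ n))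
  exceptAt zero    zero    = nothing
  exceptAt zero    (suc i) = just i
  exceptAt (suc m) zero    = just zero
  exceptAt (suc m) (suc i) = Maybe.map suc (exceptAt m i)

  insertAt : ∀ m {n} → ℤ → Env (m ℕ.+ n) → Env (m ℕ.+ suc n)
  insertAt m y ρ i = maybe′ ρ y (exceptAt m i)

  insertAt-0 : ∀ {n} {y} {ρ : Env n} → y ∷ₑ ρ ≗ insertAt 0 y ρ
  insertAt-0 zero    = refl
  insertAt-0 (suc i) = refl

  insertAt-∷ : ∀ m {n} {y z} {ρ : Env (m ℕ.+ suc n)} {ρo : Env (m ℕ.+ n)} →
               ρ ≗ insertAt m y ρo → z ∷ₑ ρ ≗ insertAt (suc m) y (z ∷ₑ ρo)
  insertAt-∷ m ρ≗ zero = refl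
  insertAt-∷ m {y = y} {z} {ρo = ρo} ρ≗ (suc i) = trans (ρ≗ i) (maybe′-map-suc (exceptAt m i))
    where
    maybe′-map-suc : ∀ mi → maybe′ ρo y mi ≡ maybe′ (z ∷ₑ ρo) y (Maybe.map suc mi)
    maybe′-map-suc nothing  = refl
    maybe′-map-suc (just _) = refl

  record Linear (n : ℕ) : Set where
    constructor _·y+_
    field
      coeff : Elt R
      rest  : Term R n
  open Linear

  linearVar : ∀ {n} → Maybe (Fin n) → Linear n
  linearVar nothing  = constᴿ 1ℤ ·y+ zer
  linearVar (just i) = constᴿ 0ℤ ·y+ var i

  linearize : ∀ m {n} → Term R (m ℕ.+ suc n) → Linear (m ℕ.+ n)
  linearize m (var i)    = linearVar (exceptAt m i)
  linearize m zer        = constᴿ 0ℤ ·y+ zer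
  linearize m one        = constᴿ 0ℤ ·y+ one
  linearize m (neg s)    = let c ·y+ r = linearize m s in (-ᴿ c) ·y+ neg r
  linearize m (add s u)  = let c ·y+ r = linearize m s ; d ·y+ q = linearize m u in
                           (c +ᴿ d) ·y+ add r q
  linearize m (smul α s) = let c ·y+ r = linearize m s in (α *ᴿ c) ·y+ smul α r

  ⟦linearize⟧ : ∀ m {n} (s : Term R (m ℕ.+ suc n)) {t y ρo ρ} → ρ ≗ insertAt m y ρo →
                ⟦ s ⟧ t ρ ≡ coeff (linearize m s) ⟨ t ⟩ * y + ⟦ rest (linearize m s) ⟧ t ρo
  ⟦linearize⟧ m (var i) {t} {y} {ρo} ρ≗ = trans (ρ≗ i) (⟦linearVar⟧ (exceptAt m i))
    where
    ⟦linearVar⟧ : ∀ mi → maybe′ ρo y mi ≡ coeff (linearVar mi) ⟨ t ⟩ * y + ⟦ rest (linearVar mi) ⟧ t ρo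
    ⟦linearVar⟧ nothing  = sym (trans (ℤP.+-identityʳ _) (ℤP.*-identityˡ y))
    ⟦linearVar⟧ (just i) = sym (ℤP.+-identityˡ _)
  ⟦linearize⟧ m zer ρ≗ = refl
  ⟦linearize⟧ m one ρ≗ = refl
  ⟦linearize⟧ m (neg s) {t} {y} {ρo} ρ≗ =
    trans (cong -_ (⟦linearize⟧ m s ρ≗)) (neg-linear (coeff ℓ ⟨ t ⟩) y (⟦ rest ℓ ⟧ t ρo))
    where
    ℓ = linearize m s
    neg-linear : ∀ c y r → - (c * y + r) ≡ - c * y + - r
    neg-linear = solve-∀
  ⟦linearize⟧ m (add s u) {t} {y} {ρo} ρ≗ =
    trans (cong₂ _+_ (⟦linearize⟧ m s ρ≗) (⟦linearize⟧ m u ρ≗))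
          (add-linear (coeff ℓ ⟨ t ⟩) (⟦ rest ℓ ⟧ t ρo) (coeff ℓ′ ⟨ t ⟩) (⟦ rest ℓ′ ⟧ t ρo) y)
    where
    ℓ = linearize m s
    ℓ′ = linearize m u
    add-linear : ∀ c r d q y → (c * y + r) + (d * y + q) ≡ (c + d) * y + (r + q)
    add-linear = solve-∀
  ⟦linearize⟧ m (smul α s) {t} {y} {ρo} ρ≗ =
    trans (cong (α ⟨ t ⟩ *_) (⟦linearize⟧ m s ρ≗))
          (smul-linear (α ⟨ t ⟩) (coeff ℓ ⟨ t ⟩) y (⟦ rest ℓ ⟧ t ρo))
    where
    ℓ = linearize m s
    smul-linear : ∀ a c y r → a * (c * y + r) ≡ a * c * y + a * r
    smul-linear = solve-∀

  ⟦⟧-shift : ∀ m {n} (s : Term R (m ℕ.+ suc n)) {t y δ ρo ρ ρ′} →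
             ρ ≗ insertAt m y ρo → ρ′ ≗ insertAt m (y + δ) ρo →
             ⟦ s ⟧ t ρ′ ≡ ⟦ s ⟧ t ρ + coeff (linearize m s) ⟨ t ⟩ * δ
  ⟦⟧-shift m s {t} {y} {δ} {ρo} {ρ} {ρ′} ρ≗ ρ′≗ = begin
    ⟦ s ⟧ t ρ′           ≡⟨ ⟦linearize⟧ m s ρ′≗ ⟩
    c * (y + δ) + r      ≡⟨ shift c y δ r ⟩
    (c * y + r) + c * δ  ≡⟨ cong (_+ c * δ) (⟦linearize⟧ m s ρ≗) ⟨
    ⟦ s ⟧ t ρ + c * δ    ∎
    where
    open ≡-Reasoning
    c = coeff (linearize m s) ⟨ t ⟩
    r = ⟦ rest (linearize m s) ⟧ t ρo
    shift : ∀ c y δ r → c * (y + δ) + r ≡ (c * y + r) + c * δ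
    shift = solve-∀

  -- Scaling by a nonzero coefficient

  scaleTerm : ∀ {k k′} → Elt R → (Fin k → Term R k′) → Term R k → Term R k′
  scaleTerm c σ (var i)    = σ i
  scaleTerm c σ zer        = zer
  scaleTerm c σ one        = smul c one
  scaleTerm c σ (neg s)    = neg (scaleTerm c σ s)
  scaleTerm c σ (add s u)  = add (scaleTerm c σ s) (scaleTerm c σ u)
  scaleTerm c σ (smul α s) = smul α (scaleTerm c σ s)

  Scales : ∀ {k k′} → Elt R → X → (Fin k → Term R k′) → Env k → Env k′ → Set
  Scales c t σ ρ ρ′ = ∀ i → ⟦ σ i ⟧ t ρ′ ≡ c ⟨ t ⟩ * ρ i

  ⟦scaleTerm⟧ : ∀ {k k′} {c t σ} {ρ : Env k} {ρ′ : Env k′} → Scales c t σ ρ ρ′ →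
                ∀ s → ⟦ scaleTerm c σ s ⟧ t ρ′ ≡ c ⟨ t ⟩ * ⟦ s ⟧ t ρ
  ⟦scaleTerm⟧ σ≡ (var i)    = σ≡ i
  ⟦scaleTerm⟧ {c = c} {t} σ≡ zer = sym (ℤP.*-zeroʳ (c ⟨ t ⟩))
  ⟦scaleTerm⟧ σ≡ one        = refl
  ⟦scaleTerm⟧ {c = c} {t} {ρ = ρ} σ≡ (neg s) =
    trans (cong -_ (⟦scaleTerm⟧ σ≡ s)) (ℤP.neg-distribʳ-* (c ⟨ t ⟩) (⟦ s ⟧ t ρ))
  ⟦scaleTerm⟧ {c = c} {t} {ρ = ρ} σ≡ (add s u) =
    trans (cong₂ _+_ (⟦scaleTerm⟧ σ≡ s) (⟦scaleTerm⟧ σ≡ u))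
          (sym (ℤP.*-distribˡ-+ (c ⟨ t ⟩) (⟦ s ⟧ t ρ) (⟦ u ⟧ t ρ)))
  ⟦scaleTerm⟧ {c = c} {t} {ρ = ρ} σ≡ (smul α s) =
    trans (cong (α ⟨ t ⟩ *_) (⟦scaleTerm⟧ σ≡ s)) (*-swap (α ⟨ t ⟩) (c ⟨ t ⟩) (⟦ s ⟧ t ρ))
    where
    *-swap : ∀ a c b → a * (c * b) ≡ c * (a * b)
    *-swap = solve-∀

  liftScaling : ∀ {k k′} → Elt R → (Fin k → Term R k′) → Fin (suc k) → Term R (suc k′)
  liftScaling c σ zero    = smul c (var zero)
  liftScaling c σ (suc i) = rename suc (σ i)

  scales-∷ : ∀ {k k′} {c t σ} {ρ : Env k} {ρ′ : Env k′} z →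
             Scales c t σ ρ ρ′ → Scales c t (liftScaling c σ) (z ∷ₑ ρ) (z ∷ₑ ρ′)
  scales-∷ z σ≡ zero    = refl
  scales-∷ {σ = σ} z σ≡ (suc i) = trans (⟦rename⟧ suc (σ i)) (σ≡ i)

  scale : ∀ {k k′} → Elt R → (Fin k → Term R k′) → BFormula k → BFormula k′
  scale c σ (eqᵇ s u)   = eqᵇ (scaleTerm c σ s) (scaleTerm c σ u)
  scale c σ (ltᵇ s u)   = orᵇ (andᵇ (ltᵇ zer (smul c one)) (ltᵇ (scaleTerm c σ s) (scaleTerm c σ u)))
                              (andᵇ (ltᵇ (smul c one) zer) (ltᵇ (scaleTerm c σ u) (scaleTerm c σ s)))
  scale c σ (dvdᵇ α s)  = dvdᵇ (c *ᴿ α) (scaleTerm c σ s)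
  scale c σ (negᵇ φ)    = negᵇ (scale c σ φ)
  scale c σ (andᵇ φ ψ)  = andᵇ (scale c σ φ) (scale c σ ψ)
  scale c σ (orᵇ φ ψ)   = orᵇ (scale c σ φ) (scale c σ ψ)
  scale c σ (impᵇ φ ψ)  = impᵇ (scale c σ φ) (scale c σ ψ)
  scale c σ (bexᵇ α φ)  = bexᵇ α (scale c (liftScaling c σ) φ)
  scale c σ (ballᵇ α φ) = ballᵇ α (scale c (liftScaling c σ) φ)

  holds-scale : ∀ {k k′} {c t σ} {ρ : Env k} {ρ′ : Env k′} → c ⟨ t ⟩ ≢ 0ℤ → Scales c t σ ρ ρ′ →
                ∀ φ → Holds (scale c σ φ) t ρ′ ⇔ Holds φ t ρ
  holds-scale {c = c} {t} c≢0 σ≡ (eqᵇ s u) =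
    subst₂ (λ a b → (a ≡ b) ⇔ _) (sym (⟦scaleTerm⟧ σ≡ s)) (sym (⟦scaleTerm⟧ σ≡ u))
           (*-cancelˡ-≡-⇔ (c ⟨ t ⟩) c≢0)
  holds-scale {c = c} {t} {ρ = ρ} c≢0 σ≡ (ltᵇ s u) =
    subst₂ (λ a′ b′ → Signs (c ⟨ t ⟩ * 1ℤ) a′ b′ ⇔ (a < b))
           (sym (⟦scaleTerm⟧ σ≡ s)) (sym (⟦scaleTerm⟧ σ≡ u))
           (subst (λ c′ → Signs c′ (c ⟨ t ⟩ * a) (c ⟨ t ⟩ * b) ⇔ (a < b))
                  (sym (ℤP.*-identityʳ (c ⟨ t ⟩))) (*-cancelˡ-<-⇔ (c ⟨ t ⟩) c≢0))
    where
    a = ⟦ s ⟧ t ρ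
    b = ⟦ u ⟧ t ρ
    Signs : ℤ → ℤ → ℤ → Set
    Signs c′ a′ b′ = (0ℤ < c′ × a′ < b′) ⊎ (c′ < 0ℤ × b′ < a′)
  holds-scale {c = c} {t} c≢0 σ≡ (dvdᵇ α s) =
    subst (λ a → (c ⟨ t ⟩ * α ⟨ t ⟩ ≢ 0ℤ × c ⟨ t ⟩ * α ⟨ t ⟩ ∣ a) ⇔ _) (sym (⟦scaleTerm⟧ σ≡ s))
          (*-cancelˡ-∣-⇔ (c ⟨ t ⟩) c≢0)
  holds-scale c≢0 σ≡ (negᵇ φ)    = ¬-cong (holds-scale c≢0 σ≡ φ)
  holds-scale c≢0 σ≡ (andᵇ φ ψ)  = ×-cong (holds-scale c≢0 σ≡ φ) (holds-scale c≢0 σ≡ ψ)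
  holds-scale c≢0 σ≡ (orᵇ φ ψ)   = ⊎-cong (holds-scale c≢0 σ≡ φ) (holds-scale c≢0 σ≡ ψ)
  holds-scale c≢0 σ≡ (impᵇ φ ψ)  = →-cong (holds-scale c≢0 σ≡ φ) (holds-scale c≢0 σ≡ ψ)
  holds-scale c≢0 σ≡ (bexᵇ α φ)  = ∃-cong-on (λ z _ → holds-scale c≢0 (scales-∷ z σ≡) φ)
  holds-scale c≢0 σ≡ (ballᵇ α φ) = ∀-cong-on (λ z _ → holds-scale c≢0 (scales-∷ z σ≡) φ)

  divisors : ∀ {n} → BFormula n → List (Elt R)
  divisors (eqᵇ s u)   = []
  divisors (ltᵇ s u)   = []
  divisors (dvdᵇ α s)  = α ∷ []
  divisors (negᵇ φ)    = divisors φ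
  divisors (andᵇ φ ψ)  = divisors φ ++ divisors ψ
  divisors (orᵇ φ ψ)   = divisors φ ++ divisors ψ
  divisors (impᵇ φ ψ)  = divisors φ ++ divisors ψ
  divisors (bexᵇ α φ)  = divisors φ
  divisors (ballᵇ α φ) = divisors φ

  period : ∀ {n} → X → BFormula n → ℕ
  period t φ = product (map (λ β → ∣ β ⟨ t ⟩ ∣⁺) (divisors φ))

  period-nonZero : ∀ {n} t (φ : BFormula n) → ℕ.NonZero (period t φ)
  period-nonZero t φ = product≢0 (All.map⁺ (All.universal (λ β → ∣i∣⁺-nonZero (β ⟨ t ⟩)) (divisors φ)))

  divisor∣period : ∀ {n} {t} (φ : BFormula n) {β} → β ∈ divisors φ → β ⟨ t ⟩ ≢ 0ℤ →
                   ∣ β ⟨ t ⟩ ∣ ℕD.∣ period t φ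
  divisor∣period {t = t} φ {β} β∈ β≢0 =
    subst (ℕD._∣ period t φ) (sym (∣i∣≡∣i∣⁺ β≢0)) (∈⇒∣product (∈-map⁺ (λ β → ∣ β ⟨ t ⟩ ∣⁺) β∈))

  squarePlus1 : Elt R → Elt R
  squarePlus1 β = β *ᴿ β +ᴿ constᴿ 1ℤ

  productᴿ : List (Elt R) → Elt R
  productᴿ = foldr _*ᴿ_ (constᴿ 1ℤ)

  bound : ∀ {n} → BFormula n → Elt R
  bound φ = productᴿ (map squarePlus1 (divisors φ))

  boundℕ : ∀ {n} → X → BFormula n → ℕ
  boundℕ t φ = product (map (λ β → ∣ β ⟨ t ⟩ ∣²+1) (divisors φ))

  bound-value : ∀ {n} t (φ : BFormula n) → bound φ ⟨ t ⟩ ≡ + boundℕ t φ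
  bound-value t φ = go (divisors φ)
    where
    go : ∀ βs → productᴿ (map squarePlus1 βs) ⟨ t ⟩ ≡ + product (map (λ β → ∣ β ⟨ t ⟩ ∣²+1) βs)
    go []       = refl
    go (β ∷ βs) = trans (cong₂ _*_ (i*i+1≡∣i∣²+1 (β ⟨ t ⟩)) (go βs))
                        (sym (ℤP.pos-* ∣ β ⟨ t ⟩ ∣²+1 (product (map (λ β → ∣ β ⟨ t ⟩ ∣²+1) βs))))

  period≤boundℕ : ∀ {n} t (φ : BFormula n) → period t φ ℕ.≤ boundℕ t φ
  period≤boundℕ t φ = product-map-mono (λ β → ∣i∣⁺≤∣i∣²+1 (β ⟨ t ⟩)) (divisors φ)

  -- Elimination of one existential quantifier

  module Eliminate {n : ℕ} (θ : BFormula (suc n)) where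

    window : Elt R → Elt R
    window c = squarePlus1 c *ᴿ bound θ

    -- near m (c ·y+ r) says that θ(y, x̄) holds for some y with |c·y + r| ≤ K_c,
    -- K_c = window c, searching k = c·y + r + K_c in [0, 2K_c] and dividing by c;
    -- x̄ sits at positions m ↑ʳ i of the context.
    yTimes : ∀ m → Elt R → Term R (m ℕ.+ n) → Term R (suc (m ℕ.+ n))
    yTimes m c r = add (var zero) (neg (add (smul (window c) one) (rename suc r)))

    substitution : ∀ m → Elt R → Term R (m ℕ.+ n) → Fin (suc n) → Term R (suc (m ℕ.+ n))
    substitution m c r zero    = yTimes m c r
    substitution m c r (suc i) = smul c (var (suc (m ↑ʳ i)))

    near : ∀ m → Linear (m ℕ.+ n) → BFormula (m ℕ.+ n)
    near m (c ·y+ r) = bexᵇ (window c +ᴿ window c)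
                            (andᵇ (dvdᵇ c (yTimes m c r)) (scale c (substitution m c r) θ))

    nearAtoms : ∀ m → BFormula (m ℕ.+ suc n) → BFormula (m ℕ.+ n)
    nearAtoms m (eqᵇ s u)   = near m (linearize m (add s (neg u)))
    nearAtoms m (ltᵇ s u)   = near m (linearize m (add s (neg u)))
    nearAtoms m (dvdᵇ α s)  = falseᵇ
    nearAtoms m (negᵇ φ)    = nearAtoms m φ
    nearAtoms m (andᵇ φ ψ)  = orᵇ (nearAtoms m φ) (nearAtoms m ψ)
    nearAtoms m (orᵇ φ ψ)   = orᵇ (nearAtoms m φ) (nearAtoms m ψ)
    nearAtoms m (impᵇ φ ψ)  = orᵇ (nearAtoms m φ) (nearAtoms m ψ)
    nearAtoms m (bexᵇ α φ)  = bexᵇ α (nearAtoms (suc m) φ)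
    nearAtoms m (ballᵇ α φ) = bexᵇ α (nearAtoms (suc m) φ)

    eliminated : BFormula n
    eliminated = orᵇ (bexᵇ (bound θ) θ) (nearAtoms 0 θ)

    Outer : ∀ m → Env (m ℕ.+ n) → Env n → Set
    Outer m ρo x = ∀ i → ρo (m ↑ʳ i) ≡ x i

    ⟦yTimes⟧ : ∀ m c r {t k} {ρo : Env (m ℕ.+ n)} →
               ⟦ yTimes m c r ⟧ t (k ∷ₑ ρo) ≡ k - (window c ⟨ t ⟩ * 1ℤ + ⟦ r ⟧ t ρo)
    ⟦yTimes⟧ m c r {t} {k} = cong (λ v → k - (window c ⟨ t ⟩ * 1ℤ + v)) (⟦rename⟧ suc r)

    near-sound : ∀ m ℓ {t x ρo} → Outer m ρo x → Holds (near m ℓ) t ρo → ∃ λ y → Holds θ t (y ∷ₑ x)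
    near-sound m (c ·y+ r) {t} {x} {ρo} outer (k , _ , (c≢0 , c∣) , θ′) =
      y , proj₁ (holds-scale c≢0 σ≡ θ) θ′
      where
      c∣′ : c ⟨ t ⟩ ℤS.∣ ⟦ yTimes m c r ⟧ t (k ∷ₑ ρo)
      c∣′ = ℤS.∣ᵤ⇒∣ {c ⟨ t ⟩} {⟦ yTimes m c r ⟧ t (k ∷ₑ ρo)} c∣
      y = ℤS._∣_.quotient c∣′
      σ≡ : Scales c t (substitution m c r) (y ∷ₑ x) (k ∷ₑ ρo)
      σ≡ zero    = trans (ℤS._∣_.equality c∣′) (ℤP.*-comm y (c ⟨ t ⟩))
      σ≡ (suc i) = cong (c ⟨ t ⟩ *_) (outer i)

    nearAtoms-sound : ∀ m φ {t x ρo} → Outer m ρo x → Holds (nearAtoms m φ) t ρo →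
                      ∃ λ y → Holds θ t (y ∷ₑ x)
    nearAtoms-sound m (eqᵇ s u)   outer h = near-sound m _ outer h
    nearAtoms-sound m (ltᵇ s u)   outer h = near-sound m _ outer h
    nearAtoms-sound m (dvdᵇ α s)  outer h = ⊥-elim (ℤP.<-irrefl refl h)
    nearAtoms-sound m (negᵇ φ)    outer h = nearAtoms-sound m φ outer h
    nearAtoms-sound m (andᵇ φ ψ)  outer h = [ nearAtoms-sound m φ outer , nearAtoms-sound m ψ outer ]′ h
    nearAtoms-sound m (orᵇ φ ψ)   outer h = [ nearAtoms-sound m φ outer , nearAtoms-sound m ψ outer ]′ h
    nearAtoms-sound m (impᵇ φ ψ)  outer h = [ nearAtoms-sound m φ outer , nearAtoms-sound m ψ outer ]′ h
    nearAtoms-sound m (bexᵇ α φ)  outer (_ , _ , h) = nearAtoms-sound (suc m) φ outer h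
    nearAtoms-sound m (ballᵇ α φ) outer (_ , _ , h) = nearAtoms-sound (suc m) φ outer h

    module _ {t : X} {x : Env n} {y : ℤ} (θy : Holds θ t (y ∷ₑ x)) where

      near-complete : ∀ m ℓ {ρo} → Outer m ρo x →
                      let c = coeff ℓ ⟨ t ⟩ ; a = c * y + ⟦ rest ℓ ⟧ t ρo ; K = window (coeff ℓ) ⟨ t ⟩ in
                      c ≢ 0ℤ → ¬ K < a → ¬ a < - K → Holds (near m ℓ) t ρo
      near-complete m (c ·y+ r) {ρo} outer c≢0 K≮a a≮-K =
        k , proj₂ inRange⇔ k∈ , (c≢0 , c∣) , proj₂ (holds-scale c≢0 σ≡ θ) θy
        where
        K = window c ⟨ t ⟩
        a = c ⟨ t ⟩ * y + ⟦ r ⟧ t ρo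
        k = a + K
        k∈ : 0ℤ ≤ k × k ≤ (K + K) * 1ℤ
        k∈ = let (0≤k , k≤2K) = near-0-window K≮a a≮-K in
             0≤k , subst (k ≤_) (sym (ℤP.*-identityʳ (K + K))) k≤2K
        yTimes≡ : ⟦ yTimes m c r ⟧ t (k ∷ₑ ρo) ≡ c ⟨ t ⟩ * y
        yTimes≡ = trans (⟦yTimes⟧ m c r {t} {k} {ρo}) (cancel (c ⟨ t ⟩) y (⟦ r ⟧ t ρo) K)
          where
          cancel : ∀ c y r K → (c * y + r + K) - (K * 1ℤ + r) ≡ c * y
          cancel = solve-∀
        c∣ : c ⟨ t ⟩ ∣ ⟦ yTimes m c r ⟧ t (k ∷ₑ ρo)
        c∣ = subst (c ⟨ t ⟩ ∣_) (sym yTimes≡) (ℤS.∣⇒∣ᵤ {c ⟨ t ⟩} {c ⟨ t ⟩ * y} (ℤS.∣m⇒∣m*n y ℤS.∣-refl))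
        σ≡ : Scales c t (substitution m c r) (y ∷ₑ x) (k ∷ₑ ρo)
        σ≡ zero    = yTimes≡
        σ≡ (suc i) = cong (c ⟨ t ⟩ *_) (outer i)

      ¬near⇒far : ∀ m ℓ {ρo} → Outer m ρo x → ¬ Holds (near m ℓ) t ρo →
                  let c = coeff ℓ ⟨ t ⟩ ; a = c * y + ⟦ rest ℓ ⟧ t ρo ; K = window (coeff ℓ) ⟨ t ⟩ in
                  c ≡ 0ℤ ⊎ K < a ⊎ a < - K
      ¬near⇒far m ℓ {ρo} outer ¬near
        with coeff ℓ ⟨ t ⟩ ℤ.≟ 0ℤ
           | window (coeff ℓ) ⟨ t ⟩ ℤP.<? coeff ℓ ⟨ t ⟩ * y + ⟦ rest ℓ ⟧ t ρo
           | coeff ℓ ⟨ t ⟩ * y + ⟦ rest ℓ ⟧ t ρo ℤP.<? - window (coeff ℓ) ⟨ t ⟩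
      ... | yes c≡0 | _        | _        = inj₁ c≡0
      ... | no _    | yes K<a  | _        = inj₂ (inj₁ K<a)
      ... | no _    | no _     | yes a<-K = inj₂ (inj₂ a<-K)
      ... | no c≢0  | no K≮a   | no a≮-K  = ⊥-elim (¬near (near-complete m ℓ outer c≢0 K≮a a≮-K))

      module _ {δ : ℤ} (∣δ∣≡P : ∣ δ ∣ ≡ period t θ) where

        window-within : ∀ c → Within (window c ⟨ t ⟩) (c ⟨ t ⟩ * δ)
        window-within c = subst (λ N → Within ((c ⟨ t ⟩ * c ⟨ t ⟩ + 1ℤ) * N) (c ⟨ t ⟩ * δ))
                                (sym (bound-value t θ)) (*-within (c ⟨ t ⟩) δ ∣δ∣≤N)
          where
          ∣δ∣≤N : ∣ δ ∣ ℕ.≤ boundℕ t θ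
          ∣δ∣≤N = subst (ℕ._≤ _) (sym ∣δ∣≡P) (period≤boundℕ t θ)

        sign-invariant : ∀ m s {ρo ρ ρ′} → Outer m ρo x →
                         ρ ≗ insertAt m y ρo → ρ′ ≗ insertAt m (y + δ) ρo →
                         ¬ Holds (near m (linearize m s)) t ρo → SameSign (⟦ s ⟧ t ρ) (⟦ s ⟧ t ρ′)
        sign-invariant m s {ρo} {ρ} outer ρ≗ ρ′≗ ¬near =
          subst (SameSign _) (sym (⟦⟧-shift m s ρ≗ ρ′≗)) (stable (¬near⇒far m ℓ outer ¬near))
          where
          ℓ = linearize m s
          c = coeff ℓ ⟨ t ⟩
          K = window (coeff ℓ) ⟨ t ⟩
          a = c * y + ⟦ rest ℓ ⟧ t ρo
          stable : c ≡ 0ℤ ⊎ K < a ⊎ a < - K → SameSign (⟦ s ⟧ t ρ) (⟦ s ⟧ t ρ + c * δ)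
          stable (inj₁ c≡0) = subst (λ c → SameSign (⟦ s ⟧ t ρ) (⟦ s ⟧ t ρ + c * δ)) (sym c≡0)
                                    (subst (SameSign _) (sym (ℤP.+-identityʳ _)) sameSign-refl)
          stable (inj₂ far) = subst (λ a → SameSign a (a + c * δ)) (sym (⟦linearize⟧ m s ρ≗))
                                    (far-from-0-sameSign (window-within (coeff ℓ)) far)

        shift-invariant : ∀ m φ {ρo ρ ρ′} → Outer m ρo x →
                          ρ ≗ insertAt m y ρo → ρ′ ≗ insertAt m (y + δ) ρo →
                          (∀ {β} → β ∈ divisors φ → β ⟨ t ⟩ ≢ 0ℤ → β ⟨ t ⟩ ∣ δ) →
                          ¬ Holds (nearAtoms m φ) t ρo → Holds φ t ρ ⇔ Holds φ t ρ′
        shift-invariant m (eqᵇ s u) outer ρ≗ ρ′≗ _ ¬near = ⇔-trans ≡⇔-≡0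
          (⇔-trans (proj₁ (sign-invariant m (add s (neg u)) outer ρ≗ ρ′≗ ¬near)) (⇔-sym ≡⇔-≡0))
        shift-invariant m (ltᵇ s u) outer ρ≗ ρ′≗ _ ¬near = ⇔-trans <⇔-<0
          (⇔-trans (proj₂ (sign-invariant m (add s (neg u)) outer ρ≗ ρ′≗ ¬near)) (⇔-sym <⇔-<0))
        shift-invariant m (dvdᵇ β s) {ρ = ρ} {ρ′} outer ρ≗ ρ′≗ β∣δ _ =
          (λ (β≢0 , β∣) → β≢0 , proj₁ (β∣-shift β≢0) β∣) , (λ (β≢0 , β∣) → β≢0 , proj₂ (β∣-shift β≢0) β∣)
          where
          β∣-shift : β ⟨ t ⟩ ≢ 0ℤ → (β ⟨ t ⟩ ∣ ⟦ s ⟧ t ρ) ⇔ (β ⟨ t ⟩ ∣ ⟦ s ⟧ t ρ′)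
          β∣-shift β≢0 = subst (λ v → (β ⟨ t ⟩ ∣ ⟦ s ⟧ t ρ) ⇔ (β ⟨ t ⟩ ∣ v)) (sym (⟦⟧-shift m s ρ≗ ρ′≗))
            (∣-shift {β ⟨ t ⟩} {δ} (⟦ s ⟧ t ρ) (coeff (linearize m s) ⟨ t ⟩) (β∣δ (here refl) β≢0))
        shift-invariant m (negᵇ φ) outer ρ≗ ρ′≗ β∣δ ¬near =
          ¬-cong (shift-invariant m φ outer ρ≗ ρ′≗ β∣δ ¬near)
        shift-invariant m (andᵇ φ ψ) outer ρ≗ ρ′≗ β∣δ ¬near = ×-cong
          (shift-invariant m φ outer ρ≗ ρ′≗ (λ β∈ → β∣δ (∈-++⁺ˡ β∈)) (¬near ∘ inj₁))
          (shift-invariant m ψ outer ρ≗ ρ′≗ (λ β∈ → β∣δ (∈-++⁺ʳ (divisors φ) β∈)) (¬near ∘ inj₂))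
        shift-invariant m (orᵇ φ ψ) outer ρ≗ ρ′≗ β∣δ ¬near = ⊎-cong
          (shift-invariant m φ outer ρ≗ ρ′≗ (λ β∈ → β∣δ (∈-++⁺ˡ β∈)) (¬near ∘ inj₁))
          (shift-invariant m ψ outer ρ≗ ρ′≗ (λ β∈ → β∣δ (∈-++⁺ʳ (divisors φ) β∈)) (¬near ∘ inj₂))
        shift-invariant m (impᵇ φ ψ) outer ρ≗ ρ′≗ β∣δ ¬near = →-cong
          (shift-invariant m φ outer ρ≗ ρ′≗ (λ β∈ → β∣δ (∈-++⁺ˡ β∈)) (¬near ∘ inj₁))
          (shift-invariant m ψ outer ρ≗ ρ′≗ (λ β∈ → β∣δ (∈-++⁺ʳ (divisors φ) β∈)) (¬near ∘ inj₂))
        shift-invariant m (bexᵇ α φ) outer ρ≗ ρ′≗ β∣δ ¬near = ∃-cong-on λ z z∈ →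
          shift-invariant (suc m) φ outer (insertAt-∷ m ρ≗) (insertAt-∷ m ρ′≗) β∣δ (λ h → ¬near (z , z∈ , h))
        shift-invariant m (ballᵇ α φ) outer ρ≗ ρ′≗ β∣δ ¬near = ∀-cong-on λ z z∈ →
          shift-invariant (suc m) φ outer (insertAt-∷ m ρ≗) (insertAt-∷ m ρ′≗) β∣δ (λ h → ¬near (z , z∈ , h))

    eliminated-sound : ∀ {t x} → Holds eliminated t x → ∃ λ y → Holds θ t (y ∷ₑ x)
    eliminated-sound (inj₁ (y , _ , θy)) = y , θy
    eliminated-sound (inj₂ h)            = nearAtoms-sound 0 θ (λ _ → refl) h

    residue⇒eliminated : ∀ {t x r} → r ℕ.< period t θ → Holds θ t (+ r ∷ₑ x) → Holds eliminated t x
    residue⇒eliminated {t} {x} {r} r<P θr = inj₁ (+ r , proj₂ inRange⇔ (ℤ.+≤+ ℕ.z≤n , r≤N) , θr)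
      where
      r≤N : + r ≤ bound θ ⟨ t ⟩ * 1ℤ
      r≤N = subst (+ r ≤_) (sym (trans (ℤP.*-identityʳ _) (bound-value t θ)))
                  (ℤ.+≤+ (ℕP.≤-trans (ℕP.<⇒≤ r<P) (period≤boundℕ t θ)))

    crossing⇒eliminated : ∀ {t x} → Crossing (λ z → holds? θ t (z ∷ₑ x)) (period t θ) →
                          Holds eliminated t x
    crossing⇒eliminated {t} {x} (y , δ , ∣δ∣≡P , θy , ¬θy+δ) with holds? (nearAtoms 0 θ) t x
    ... | yes h  = inj₂ h
    ... | no ¬h = ⊥-elim (¬θy+δ (proj₁ θy⇔θy+δ θy))
      where
      β∣δ : ∀ {β} → β ∈ divisors θ → β ⟨ t ⟩ ≢ 0ℤ → β ⟨ t ⟩ ∣ δ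
      β∣δ {β} β∈ β≢0 = subst (∣ β ⟨ t ⟩ ∣ ℕD.∣_) (sym ∣δ∣≡P) (divisor∣period θ β∈ β≢0)
      θy⇔θy+δ : Holds θ t (y ∷ₑ x) ⇔ Holds θ t (y + δ ∷ₑ x)
      θy⇔θy+δ = shift-invariant θy ∣δ∣≡P 0 θ (λ _ → refl) insertAt-0 insertAt-0 β∣δ ¬h

    eliminated-correct : ∀ t x → (∃ λ y → Holds θ t (y ∷ₑ x)) ⇔ Holds eliminated t x
    eliminated-correct t x = complete , eliminated-sound
      where
      complete : (∃ λ y → Holds θ t (y ∷ₑ x)) → Holds eliminated t x
      complete (z , θz) = [ (λ (r , r<P , θr) → residue⇒eliminated r<P θr) , crossing⇒eliminated ]′
        (residue-or-crossing (λ z → holds? θ t (z ∷ₑ x)) (period t θ) {{period-nonZero t θ}} θz)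

  open Eliminate using (eliminated; eliminated-correct)

  toBounded : ∀ {d} (φ : Formula R d) → Σ[ ψ ∈ BFormula d ] ∀ t ρ → Sat R φ t ρ ⇔ Holds ψ t ρ
  toBounded (eq s u)   = eqᵇ s u , λ _ _ → ⇔-refl
  toBounded (lt s u)   = ltᵇ s u , λ _ _ → ⇔-refl
  toBounded (dvd α s)  = dvdᵇ α s , λ _ _ → ⇔-refl
  toBounded (fneg φ)   = let ψ , φ⇔ψ = toBounded φ in negᵇ ψ , λ t ρ → ¬-cong (φ⇔ψ t ρ)
  toBounded (fand φ χ) = let ψ , φ⇔ψ = toBounded φ ; ω , χ⇔ω = toBounded χ in
                         andᵇ ψ ω , λ t ρ → ×-cong (φ⇔ψ t ρ) (χ⇔ω t ρ)
  toBounded (for φ χ)  = let ψ , φ⇔ψ = toBounded φ ; ω , χ⇔ω = toBounded χ in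
                         orᵇ ψ ω , λ t ρ → ⊎-cong (φ⇔ψ t ρ) (χ⇔ω t ρ)
  toBounded (fimp φ χ) = let ψ , φ⇔ψ = toBounded φ ; ω , χ⇔ω = toBounded χ in
                         impᵇ ψ ω , λ t ρ → →-cong (φ⇔ψ t ρ) (χ⇔ω t ρ)
  toBounded (ex φ)     = let ψ , φ⇔ψ = toBounded φ in
    eliminated ψ , λ t ρ → ⇔-trans (∃-cong λ z → φ⇔ψ t (z ∷ₑ ρ)) (eliminated-correct ψ t ρ)
  toBounded (all φ)    = let ψ , φ⇔ψ = toBounded φ in
    negᵇ (eliminated (negᵇ ψ)) , λ t ρ →
      ⇔-trans (∀-cong λ z → φ⇔ψ t (z ∷ₑ ρ))
     (⇔-trans (∀⇔¬∃¬ λ z → holds? ψ t (z ∷ₑ ρ))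
              (¬-cong (eliminated-correct (negᵇ ψ) t ρ)))

theorem1p4 : {X : Set} (x₀ : X) (R : (X → ℤ) → Set) → IsFunRing R →
    (d : ℕ) (φ : Formula R d) →
    Σ (Formula R d) λ ψ → Bounded R ψ × LogEquiv R φ ψ
theorem1p4 _ R isFunRing d φ =
  let open QuantifierElimination R isFunRing ; ψ , φ⇔ψ = toBounded φ in
  embed ψ , embed-bounded ψ , φ⇔ψ
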